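{- Let $S=\{R_0,\ldots,R_d\}$ be an association scheme on a nonempty finite set $X$ and $\mathbb{F}$ a field. If $S$ is triply regular (over $\mathbb{F}$), then $S$ has no bad pair.
   Context: An association scheme on $X$ is a partition $S=\{R_0,\ldots,R_d\}$ of $X\times X$ into nonempty relations with $R_0$ the diagonal, closed under transposes ($R_{c'}$ the transpose of $R_c$), with $p_{ij}^k=|\{\ell:(m,\ell)\in R_i,(\ell,n)\in R_j\}|$ independent of $(m,n)\in R_k$. Valency $k_a=|yR_a|$, $yR_a=\{z:(y,z)\in R_a\}$; $R_aR_b=\{R_c:p_{ab}^c>0\}$. For $y\in X$, $A_b\in M_X(\mathbb{F})$ is the $(0,1)$ adjacency matrix of $R_b$ and $E_z^*(y)$ the diagonal $(0,1)$-matrix with $(i,i)$-entry $1$ iff $i\in yR_z$; the matrices $E_z^*(y)A_bE_j^*(y)$ are the triple products for $y$. $S$ is triply regular if for every $y\in X$ the $\mathbb{F}$-linear span of all triple products for $y$ is a unital $\mathbb{F}$-subalgebra of $M_X(\mathbb{F})$. A pair $(u,v)$ is a bad pair of $S$ if there exist an integer $a\ge1$ and indices $i_b,j_b,\ell_b$ ($b=0,\ldots,a$) with $i_0=u$, $\ell_a=v$, $k_{i_b}=k_{\ell_b}=2$, $p_{i_bj_b}^{\ell_b}=1$ for all $b$, $\ell_c=i_{c+1}$ for $c=0,\ldots,a-1$, and $|R_{i_0'}R_{\ell_a}|=1$. -}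

module Defs where

open import Level using (Level; _⊔_)
open import Data.Nat as ℕ using (ℕ; zero; suc; _≥_)
open import Data.Fin using (Fin; zero; suc)
open import Data.Fin.Properties using (_≟_)
open import Data.Product using (Σ; ∃; ∃-syntax; _×_; _,_)
open import Relation.Nullary using (¬_; yes; no)
open import Relation.Binary.PropositionalEquality using (_≡_; _≢_)
open import Algebra.Bundles using (CommutativeRing)

countEq : {n m : ℕ} → (Fin n → Fin m) → Fin m → ℕ
countEq {zero}  f c = 0
countEq {suc n} f c with f zero ≟ c
... | yes _ = suc (countEq (λ x → f (suc x)) c)
... | no  _ = countEq (λ x → f (suc x)) c

countEq₂ : {n m : ℕ} → (Fin n → Fin m) → Fin m → (Fin n → Fin m) → Fin m → ℕ
countEq₂ {zero}  f a g b = 0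
countEq₂ {suc n} f a g b with f zero ≟ a | g zero ≟ b
... | yes _ | yes _ = suc (countEq₂ (λ x → f (suc x)) a (λ x → g (suc x)) b)
... | _     | _     = countEq₂ (λ x → f (suc x)) a (λ x → g (suc x)) b

countPos : {n : ℕ} → (Fin n → ℕ) → ℕ
countPos {zero}  h = 0
countPos {suc n} h with h zero
... | zero  = countPos (λ x → h (suc x))
... | suc _ = suc (countPos (λ x → h (suc x)))

-- Association schemes on X = Fin n (nonempty X is taken as X = Fin (suc m)) with relations R_0,…,R_d
-- The partition {R_0,…,R_d} of X×X is encoded by the function
-- rel : X → X → Fin (suc d),  (x,y) ∈ R_c  iff  rel x y ≡ c.

record AssociationScheme (n d : ℕ) : Set where
  field
    rel      : Fin n → Fin n → Fin (suc d)
    nonempty : ∀ c → ∃[ x ] ∃[ y ] rel x y ≡ c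
    diag     : ∀ x y → rel x y ≡ zero → x ≡ y
    diag-refl : ∀ x → rel x x ≡ zero
    tr       : Fin (suc d) → Fin (suc d)
    tr-rel   : ∀ x y → rel y x ≡ tr (rel x y)
    p        : Fin (suc d) → Fin (suc d) → Fin (suc d) → ℕ
    p-spec   : ∀ i j k x y → rel x y ≡ k →
               countEq₂ (λ l → rel x l) i (λ l → rel l y) j ≡ p i j k

module _ {m d : ℕ} (S : AssociationScheme (suc m) d) where
  open AssociationScheme S

  yR-size : Fin (suc m) → Fin (suc d) → ℕ
  yR-size y a = countEq (λ z → rel y z) a

  -- valency k_a = |yR_a| (independent of y; X = Fin (suc m) is nonempty,
  -- and we take y = the point zero)
  valency : Fin (suc d) → ℕ
  valency a = yR-size zero a

  -- |R_a R_b| = number of c with p_{ab}^c > 0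
  prodSize : Fin (suc d) → Fin (suc d) → ℕ
  prodSize a b = countPos (λ c → p a b c)

  BadPair : Fin (suc d) → Fin (suc d) → Set
  BadPair u v =
    ∃[ a ] (a ≥ 1 ×
      Σ (Fin (suc a) → Fin (suc d)) λ i →
      Σ (Fin (suc a) → Fin (suc d)) λ j →
      Σ (Fin (suc a) → Fin (suc d)) λ ℓ →
        i zero ≡ u ×
        ℓ (Data.Fin.fromℕ a) ≡ v ×
        (∀ b → valency (i b) ≡ 2) ×
        (∀ b → valency (ℓ b) ≡ 2) ×
        (∀ b → p (i b) (j b) (ℓ b) ≡ 1) ×
        (∀ (c : Fin a) → ℓ (Data.Fin.inject₁ c) ≡ i (suc c)) ×
        prodSize (tr (i zero)) (ℓ (Data.Fin.fromℕ a)) ≡ 1)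

record Field (c ℓ : Level) : Set (Level.suc (c ⊔ ℓ)) where
  field
    commRing : CommutativeRing c ℓ
  open CommutativeRing commRing public
  field
    0≉1     : ¬ (0# ≈ 1#)
    inverse : ∀ x → ¬ (x ≈ 0#) → ∃[ y ] (x * y ≈ 1#)

module Matrices {c ℓ : Level} (F : Field c ℓ) where
  open Field F using (Carrier; _≈_; _+_; _*_; 0#; 1#)

  Σ[<_] : ∀ k → (Fin k → Carrier) → Carrier
  Σ[< zero  ] f = 0#
  Σ[< suc k ] f = f zero + Σ[< k ] (λ x → f (suc x))

  Mat : ℕ → Set c
  Mat n = Fin n → Fin n → Carrier

  _≈ᴹ_ : ∀ {n} → Mat n → Mat n → Set ℓ
  A ≈ᴹ B = ∀ x y → A x y ≈ B x y

  _·_ : ∀ {n} → Mat n → Mat n → Mat n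
  _·_ {n} A B x y = Σ[< n ] (λ z → A x z * B z y)

  I : ∀ {n} → Mat n
  I x y with x ≟ y
  ... | yes _ = 1#
  ... | no  _ = 0#

  ind : ∀ {n d} → (Fin n → Fin n → Fin (suc d)) → Fin (suc d) → Mat n
  ind r b x y with r x y ≟ b
  ... | yes _ = 1#
  ... | no  _ = 0#

  InSpan : ∀ {n k} → (Fin k → Mat n) → Mat n → Set (c ⊔ ℓ)
  InSpan {n} {k} T M =
    Σ (Fin k → Carrier) λ α → (∀ x y → M x y ≈ Σ[< k ] (λ t → α t * T t x y))

  -- the span of T is a unital subalgebra of M_X(F)
  -- (closure under + and scalars is automatic for a span)
  IsUnitalSubalgebraSpan : ∀ {n k} → (Fin k → Mat n) → Set (c ⊔ ℓ)
  IsUnitalSubalgebraSpan T =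
    InSpan T I × (∀ A B → InSpan T A → InSpan T B → InSpan T (A · B))

  module _ {n d : ℕ} (S : AssociationScheme n d) where
    open AssociationScheme S

    Adj : Fin (suc d) → Mat n
    Adj b = ind rel b

    Estar : Fin (suc d) → Fin n → Mat n
    Estar z y u v with u ≟ v | rel y u ≟ z
    ... | yes _ | yes _ = 1#
    ... | _     | _     = 0#

    tripleProducts : Fin n → Fin (suc d ℕ.* (suc d ℕ.* suc d)) → Mat n
    tripleProducts y t with Data.Fin.remQuot {suc d} (suc d ℕ.* suc d) t
    ... | (z , t') with Data.Fin.remQuot {suc d} (suc d) t'
    ... | (b , j) = (Estar z y · Adj b) · Estar j y

    TriplyRegular : Set (c ⊔ ℓ)
    TriplyRegular = ∀ y → IsUnitalSubalgebraSpan (tripleProducts y)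

-- Fix a base point y and write T for the span of the triple products for y.
-- Every matrix in T has its (u, v) entry determined by the triple of relations
-- (rel y u, rel u v, rel y v). When p_{ij}^ℓ = 1, the column of E*_i A_j E*_ℓ
-- at any v ∈ yR_ℓ is a unit vector e_w with w ∈ yR_i; multiplying such products
-- along a bad chain gives, by triple regularity, a matrix M ∈ T whose column at
-- some v ∈ yR_{ℓ_a} is e_u with u ∈ yR_{i_0}. As k_{i_0} = 2 there is a second
-- point u' ∈ yR_{i_0}, and |R_{i_0'} R_{ℓ_a}| = 1 forces rel u v = rel u' v, so
-- M u v = M u' v, i.e. 1 = 0.
module Submission where

open import Defs
open import Level using (Level)
open import Data.Nat as ℕ using (ℕ; suc; zero; _≤_; _<_; z≤n; s≤s; s≤s⁻¹)
open import Data.Nat.Properties using (≤-trans; ≤-refl; n≤1+n; ≤-reflexive; ≤⇒≯)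
open import Data.Fin using (Fin; zero; suc; inject₁; fromℕ; combine; remQuot)
open import Data.Fin.Properties using (_≟_; suc-injective; remQuot-combine; punchInᵢ≢i)
open import Data.Vec.Functional using (removeAt; replicate)
open import Data.Product using (∃-syntax; _×_; _,_; proj₂)
open import Data.Empty using (⊥; ⊥-elim)
open import Function.Base using (_∘_)
open import Relation.Nullary using (¬_; yes; no; contradiction)
open import Relation.Binary.PropositionalEquality as P using (_≡_; _≢_)

countEq-witness : ∀ {n k} (f : Fin n → Fin k) c → 1 ≤ countEq f c → ∃[ x ] f x ≡ c
countEq-witness {suc n} f c h with f zero ≟ c
... | yes fx = zero , fx
... | no _   = let x , fx = countEq-witness (f ∘ suc) c h in suc x , fx

countEq-another-witness : ∀ {n k} (f : Fin n → Fin k) c → 2 ≤ countEq f c →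
                          ∀ x → ∃[ x' ] (x' ≢ x × f x' ≡ c)
countEq-another-witness {suc n} f c h x with f zero ≟ c | x
... | yes f0 | suc _ = zero , (λ ()) , f0
... | yes _  | zero  = let x' , fx' = countEq-witness (f ∘ suc) c (s≤s⁻¹ h) in suc x' , (λ ()) , fx'
... | no _   | zero  = let x' , fx' = countEq-witness (f ∘ suc) c (≤-trans (n≤1+n 1) h) in suc x' , (λ ()) , fx'
... | no _   | suc x₀ =
  let x' , x'≢x₀ , fx' = countEq-another-witness (f ∘ suc) c h x₀ in suc x' , x'≢x₀ ∘ suc-injective , fx'

countEq₂-pos : ∀ {n k} (f : Fin n → Fin k) a g b {x} → f x ≡ a → g x ≡ b → 1 ≤ countEq₂ f a g b
countEq₂-pos {suc n} f a g b {zero} fx gx with f zero ≟ a | g zero ≟ b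
... | yes _  | yes _  = s≤s z≤n
... | yes _  | no ¬gx = contradiction gx ¬gx
... | no ¬fx | _      = contradiction fx ¬fx
countEq₂-pos {suc n} f a g b {suc x} fx gx with f zero ≟ a | g zero ≟ b
... | yes _ | yes _ = s≤s z≤n
... | yes _ | no _  = countEq₂-pos (f ∘ suc) a (g ∘ suc) b fx gx
... | no _  | _     = countEq₂-pos (f ∘ suc) a (g ∘ suc) b fx gx

countEq₂-witness : ∀ {n k} (f : Fin n → Fin k) a g b → 1 ≤ countEq₂ f a g b → ∃[ x ] (f x ≡ a × g x ≡ b)
countEq₂-witness {suc n} f a g b h with f zero ≟ a | g zero ≟ b
... | yes fx | yes gx = zero , fx , gx
... | yes _  | no _   = let x , fgx = countEq₂-witness (f ∘ suc) a (g ∘ suc) b h in suc x , fgx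
... | no _   | _      = let x , fgx = countEq₂-witness (f ∘ suc) a (g ∘ suc) b h in suc x , fgx

countEq₂-at-most-one : ∀ {n k} (f : Fin n → Fin k) a g b → countEq₂ f a g b ≤ 1 → ∀ {x x'} →
                       f x ≡ a → g x ≡ b → f x' ≡ a → g x' ≡ b → x ≡ x'
countEq₂-at-most-one {suc n} f a g b le {zero} {zero} _ _ _ _ = P.refl
countEq₂-at-most-one {suc n} f a g b le {zero} {suc x'} fx gx fx' gx' with f zero ≟ a | g zero ≟ b
... | yes _  | yes _  = ⊥-elim (≤⇒≯ (s≤s⁻¹ le) (countEq₂-pos (f ∘ suc) a (g ∘ suc) b fx' gx'))
... | yes _  | no ¬gx = contradiction gx ¬gx
... | no ¬fx | _      = contradiction fx ¬fx
countEq₂-at-most-one {suc n} f a g b le {suc x} {zero} fx gx fx' gx' =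
  P.sym (countEq₂-at-most-one f a g b le fx' gx' fx gx)
countEq₂-at-most-one {suc n} f a g b le {suc x} {suc x'} fx gx fx' gx' with f zero ≟ a | g zero ≟ b
... | yes _ | yes _ = ⊥-elim (≤⇒≯ (s≤s⁻¹ le) (countEq₂-pos (f ∘ suc) a (g ∘ suc) b fx gx))
... | yes _ | no _  = P.cong suc (countEq₂-at-most-one (f ∘ suc) a (g ∘ suc) b le fx gx fx' gx')
... | no _  | _     = P.cong suc (countEq₂-at-most-one (f ∘ suc) a (g ∘ suc) b le fx gx fx' gx')

countPos-pos : ∀ {n} (h : Fin n → ℕ) {c} → 0 < h c → 1 ≤ countPos h
countPos-pos {suc n} h {zero} hc with h zero
... | suc _ = s≤s z≤n
countPos-pos {suc n} h {suc c} hc with h zero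
... | zero  = countPos-pos (h ∘ suc) hc
... | suc _ = s≤s z≤n

countPos-tail-≤ : ∀ {n} (h : Fin (suc n) → ℕ) → countPos (h ∘ suc) ≤ countPos h
countPos-tail-≤ h with h zero
... | zero  = ≤-refl
... | suc _ = n≤1+n _

countPos-at-most-one : ∀ {n} (h : Fin n → ℕ) → countPos h ≤ 1 → ∀ {c c'} → 0 < h c → 0 < h c' → c ≡ c'
countPos-at-most-one {suc n} h le {zero} {zero} _ _ = P.refl
countPos-at-most-one {suc n} h le {zero} {suc c'} hc hc' with h zero
... | suc _ = ⊥-elim (≤⇒≯ (s≤s⁻¹ le) (countPos-pos (h ∘ suc) hc'))
countPos-at-most-one {suc n} h le {suc c} {zero} hc hc' = P.sym (countPos-at-most-one h le hc' hc)
countPos-at-most-one {suc n} h le {suc c} {suc c'} hc hc' =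
  P.cong suc (countPos-at-most-one (h ∘ suc) (≤-trans (countPos-tail-≤ h) le) hc hc')

module _ {n d : ℕ} (S : AssociationScheme n d) where
  open AssociationScheme S

  p-pos : ∀ {x l y i j} → rel x l ≡ i → rel l y ≡ j → 0 < p i j (rel x y)
  p-pos {x} {l} {y} {i} {j} xl ly =
    P.subst (1 ≤_) (p-spec i j (rel x y) x y P.refl) (countEq₂-pos (rel x) i (λ l → rel l y) j xl ly)

  p≡1⇒unique-middle : ∀ {x y i j k} → rel x y ≡ k → p i j k ≡ 1 →
    ∃[ l ] (rel x l ≡ i × rel l y ≡ j × (∀ {l'} → rel x l' ≡ i → rel l' y ≡ j → l' ≡ l))
  p≡1⇒unique-middle {x} {y} {i} {j} {k} xy p≡1 =
    let count≡1 = P.trans (p-spec i j k x y xy) p≡1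
        l , xl , ly = countEq₂-witness (rel x) i (λ l → rel l y) j (≤-reflexive (P.sym count≡1))
    in l , xl , ly , λ xl' l'y →
         countEq₂-at-most-one (rel x) i (λ l → rel l y) j (≤-reflexive count≡1) xl' l'y xl ly

module _ {m d : ℕ} (S : AssociationScheme (suc m) d) where
  open AssociationScheme S

  prodSize≡1⇒rel-constant : ∀ {y u u' v i ℓ} → prodSize S (tr i) ℓ ≡ 1 →
    rel y u ≡ i → rel y u' ≡ i → rel y v ≡ ℓ → rel u v ≡ rel u' v
  prodSize≡1⇒rel-constant {y} {u} {u'} {v} {i} {ℓ} ps yu yu' yv =
    countPos-at-most-one (p (tr i) ℓ) (≤-reflexive ps) (through yu) (through yu')
    where
      through : ∀ {x} → rel y x ≡ i → 0 < p (tr i) ℓ (rel x v)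
      through {x} yx = p-pos S (P.trans (tr-rel y x) (P.cong tr yx)) yv

module _ {c ℓ : Level} (F : Field c ℓ) where
  open Field F using (Carrier; _≈_; _+_; _*_; 0#; 1#; 0≉1; setoid; semiring;
                      refl; sym; trans; *-cong; *-congˡ; *-congʳ; +-congˡ;
                      +-identityʳ; *-identityˡ; *-identityʳ; zeroˡ; zeroʳ)
  open Matrices F
  open import Algebra.Properties.Semiring.Sum semiring using (sum; sum-cong-≋; sum-remove; sum-replicate-zero)
  open import Relation.Binary.Reasoning.Setoid setoid

  Σ≡sum : ∀ k (f : Fin k → Carrier) → Σ[< k ] f ≡ sum f
  Σ≡sum zero    f = P.refl
  Σ≡sum (suc k) f = P.cong (f zero +_) (Σ≡sum k (f ∘ suc))

  Σ-cong : ∀ {k} {f g : Fin k → Carrier} → (∀ t → f t ≈ g t) → Σ[< k ] f ≈ Σ[< k ] g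
  Σ-cong {k} {f} {g} f≈g = begin
    Σ[< k ] f  ≡⟨ Σ≡sum k f ⟩
    sum f      ≈⟨ sum-cong-≋ f≈g ⟩
    sum g      ≡⟨ Σ≡sum k g ⟨
    Σ[< k ] g  ∎

  Σ-single : ∀ {k} (f : Fin k → Carrier) t₀ → (∀ t → t ≢ t₀ → f t ≈ 0#) → Σ[< k ] f ≈ f t₀
  Σ-single {suc k} f t₀ vanish = begin
    Σ[< suc k ] f                ≡⟨ Σ≡sum (suc k) f ⟩
    sum f                        ≈⟨ sum-remove {i = t₀} f ⟩
    f t₀ + sum (removeAt f t₀)   ≈⟨ +-congˡ (sum-cong-≋ (λ t → vanish _ (punchInᵢ≢i t₀ t))) ⟩
    f t₀ + sum (replicate k 0#)  ≈⟨ +-congˡ (sum-replicate-zero k) ⟩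
    f t₀ + 0#                    ≈⟨ +-identityʳ _ ⟩
    f t₀                         ∎

  I-≡ : ∀ {k} {i j : Fin k} → i ≡ j → I i j ≈ 1#
  I-≡ {i = i} {j} i≡j with i ≟ j
  ... | yes _   = refl
  ... | no i≢j = contradiction i≡j i≢j

  I-≢ : ∀ {k} {i j : Fin k} → i ≢ j → I i j ≈ 0#
  I-≢ {i = i} {j} i≢j with i ≟ j
  ... | yes i≡j = contradiction i≡j i≢j
  ... | no _    = refl

  I*I≈0 : ∀ {k l} {i i' : Fin k} {j j' : Fin l} → ¬ (i ≡ i' × j ≡ j') → I i i' * I j j' ≈ 0#
  I*I≈0 {i = i} {i'} {j} {j'} ¬both with i ≟ i' | j ≟ j'
  ... | yes i≡i' | yes j≡j' = contradiction (i≡i' , j≡j') ¬both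
  ... | yes _    | no _     = zeroʳ _
  ... | no _     | _        = zeroˡ _

  IsDiagonal : ∀ {n} → Mat n → Set ℓ
  IsDiagonal D = ∀ u v → u ≢ v → D u v ≈ 0#

  ·-diagonalˡ : ∀ {n} {D A : Mat n} → IsDiagonal D → ∀ u w → (D · A) u w ≈ D u u * A u w
  ·-diagonalˡ diag u w = Σ-single _ u (λ x x≢u → trans (*-congʳ (diag u x (x≢u ∘ P.sym))) (zeroˡ _))

  ·-diagonalʳ : ∀ {n} {A D : Mat n} → IsDiagonal D → ∀ u v → (A · D) u v ≈ A u v * D v v
  ·-diagonalʳ diag u v = Σ-single _ v (λ x x≢v → trans (*-congˡ (diag x v x≢v)) (zeroʳ _))

  UnitColumn : ∀ {n} → Mat n → Fin n → Fin n → Set ℓ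
  UnitColumn M u v = M u v ≈ 1# × (∀ u' → u' ≢ u → M u' v ≈ 0#)

  UnitColumn-· : ∀ {n} {A B : Mat n} {u w v} → UnitColumn A u w → UnitColumn B w v → UnitColumn (A · B) u v
  UnitColumn-· {A = A} {B} {u} {w} {v} (Auw≈1 , Acol) (Bwv≈1 , Bcol) =
    trans (through u) (trans (*-cong Auw≈1 Bwv≈1) (*-identityˡ 1#)) ,
    λ u' u'≢u → trans (through u') (trans (*-cong (Acol u' u'≢u) Bwv≈1) (zeroˡ 1#))
    where
      through : ∀ x → (A · B) x v ≈ A x w * B w v
      through x = Σ-single _ w (λ w' w'≢w → trans (*-congˡ (Bcol w' w'≢w)) (zeroʳ _))

  InSpan-generator : ∀ {n k} (T : Fin k → Mat n) t → InSpan T (T t)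
  InSpan-generator T t = (λ s → I t s) , λ x y → sym (begin
    Σ[< _ ] (λ s → I t s * T s x y)  ≈⟨ Σ-single _ t (λ s s≢t → trans (*-congʳ (I-≢ (s≢t ∘ P.sym))) (zeroˡ _)) ⟩
    I t t * T t x y                  ≈⟨ *-congʳ (I-≡ {i = t} P.refl) ⟩
    1# * T t x y                     ≈⟨ *-identityˡ _ ⟩
    T t x y                          ∎)

  InSpan-entry-≈ : ∀ {n k} (T : Fin k → Mat n) {M u v u' v'} →
    (∀ t → T t u v ≈ T t u' v') → InSpan T M → M u v ≈ M u' v'
  InSpan-entry-≈ T {M} {u} {v} {u'} {v'} generators (α , M≈) = begin
    M u v                            ≈⟨ M≈ u v ⟩
    Σ[< _ ] (λ t → α t * T t u v)    ≈⟨ Σ-cong (λ t → *-congˡ (generators t)) ⟩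
    Σ[< _ ] (λ t → α t * T t u' v')  ≈⟨ M≈ u' v' ⟨
    M u' v'                          ∎

  module _ {n d : ℕ} (S : AssociationScheme n d) (y : Fin n) where
    open AssociationScheme S

    tripleProduct : Fin (suc d) → Fin (suc d) → Fin (suc d) → Mat n
    tripleProduct z b j = (Estar S z y · Adj S b) · Estar S j y

    Estar-diagonal : ∀ z → IsDiagonal (Estar S z y)
    Estar-diagonal z u v u≢v with u ≟ v
    ... | yes u≡v = contradiction u≡v u≢v
    ... | no _    = refl

    Estar-diagonal-entry : ∀ z u → Estar S z y u u ≡ I (rel y u) z
    Estar-diagonal-entry z u with u ≟ u | rel y u ≟ z
    ... | yes _ | yes _ = P.refl
    ... | yes _ | no _  = P.refl
    ... | no u≢u | _    = contradiction P.refl u≢u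

    Adj-entry : ∀ b u v → Adj S b u v ≡ I (rel u v) b
    Adj-entry b u v with rel u v ≟ b
    ... | yes _ = P.refl
    ... | no _  = P.refl

    tripleProduct-entry : ∀ z b j u v →
      tripleProduct z b j u v ≈ I (rel y u) z * I (rel u v) b * I (rel y v) j
    tripleProduct-entry z b j u v = begin
      tripleProduct z b j u v                                ≈⟨ ·-diagonalʳ {A = Estar S z y · Adj S b} (Estar-diagonal j) u v ⟩
      (Estar S z y · Adj S b) u v * Estar S j y v v          ≈⟨ *-congʳ (·-diagonalˡ {A = Adj S b} (Estar-diagonal z) u v) ⟩
      Estar S z y u u * Adj S b u v * Estar S j y v v        ≡⟨ P.cong₂ _*_ (P.cong₂ _*_ (Estar-diagonal-entry z u) (Adj-entry b u v))
                                                                          (Estar-diagonal-entry j v) ⟩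
      I (rel y u) z * I (rel u v) b * I (rel y v) j          ∎

    tripleProducts-shape : ∀ t → ∃[ z ] ∃[ b ] ∃[ j ] tripleProducts S y t ≡ tripleProduct z b j
    tripleProducts-shape t =
      let z , t' = remQuot {suc d} (suc d ℕ.* suc d) t
          b , j  = remQuot {suc d} (suc d) t'
      in z , b , j , P.refl

    tripleProducts-combine : ∀ z b j → tripleProducts S y (combine z (combine b j)) ≡ tripleProduct z b j
    tripleProducts-combine z b j =
      P.trans (P.cong (λ (z , t') → let b , j = remQuot (suc d) t' in tripleProduct z b j)
                      (remQuot-combine z (combine b j)))
              (P.cong (λ (b , j) → tripleProduct z b j) (remQuot-combine b j))

    tripleProduct-InSpan : ∀ z b j → InSpan (tripleProducts S y) (tripleProduct z b j)
    tripleProduct-InSpan z b j =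
      P.subst (InSpan (tripleProducts S y)) (tripleProducts-combine z b j)
              (InSpan-generator (tripleProducts S y) (combine z (combine b j)))

    tripleProduct-entry-≈ : ∀ z b j {u v u' v'} →
      rel y u ≡ rel y u' → rel u v ≡ rel u' v' → rel y v ≡ rel y v' →
      tripleProduct z b j u v ≈ tripleProduct z b j u' v'
    tripleProduct-entry-≈ z b j {u} {v} {u'} {v'} yu yuv yv = begin
      tripleProduct z b j u v                            ≈⟨ tripleProduct-entry z b j u v ⟩
      I (rel y u) z * I (rel u v) b * I (rel y v) j      ≡⟨ P.cong₂ _*_ (P.cong₂ _*_ (P.cong (λ r → I r z) yu)
                                                             (P.cong (λ r → I r b) yuv)) (P.cong (λ r → I r j) yv) ⟩
      I (rel y u') z * I (rel u' v') b * I (rel y v') j  ≈⟨ tripleProduct-entry z b j u' v' ⟨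
      tripleProduct z b j u' v'                          ∎

    InSpan-tripleProducts-entry-≈ : ∀ {M u v u' v'} → InSpan (tripleProducts S y) M →
      rel y u ≡ rel y u' → rel u v ≡ rel u' v' → rel y v ≡ rel y v' → M u v ≈ M u' v'
    InSpan-tripleProducts-entry-≈ {u = u} {v} {u'} {v'} M∈span yu yuv yv =
      InSpan-entry-≈ _ generator-entry-≈ M∈span
      where
        generator-entry-≈ : ∀ t → tripleProducts S y t u v ≈ tripleProducts S y t u' v'
        generator-entry-≈ t =
          let z , b , j , eq = tripleProducts-shape t
          in P.subst (λ N → N u v ≈ N u' v') (P.sym eq) (tripleProduct-entry-≈ z b j yu yuv yv)

    UnitColumnsOver : Mat n → Fin (suc d) → Fin (suc d) → Set ℓ
    UnitColumnsOver M i k = ∀ v → rel y v ≡ k → ∃[ u ] (rel y u ≡ i × UnitColumn M u v)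

    tripleProduct-unitColumns : ∀ {z b j} → p z b j ≡ 1 → UnitColumnsOver (tripleProduct z b j) z j
    tripleProduct-unitColumns {z} {b} {j} p≡1 v yv =
      let w , yw , wv , unique = p≡1⇒unique-middle S yv p≡1
      in w , yw , entry-at-w yw wv , λ w' w'≢w → entry-off-w (λ (yw' , w'v) → w'≢w (unique yw' w'v))
      where
        entry-at-w : ∀ {w} → rel y w ≡ z → rel w v ≡ b → tripleProduct z b j w v ≈ 1#
        entry-at-w {w} yw wv = begin
          tripleProduct z b j w v                        ≈⟨ tripleProduct-entry z b j w v ⟩
          I (rel y w) z * I (rel w v) b * I (rel y v) j  ≈⟨ *-cong (*-cong (I-≡ yw) (I-≡ wv)) (I-≡ yv) ⟩
          1# * 1# * 1#                                   ≈⟨ trans (*-identityʳ _) (*-identityˡ _) ⟩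
          1#                                             ∎

        entry-off-w : ∀ {w'} → ¬ (rel y w' ≡ z × rel w' v ≡ b) → tripleProduct z b j w' v ≈ 0#
        entry-off-w {w'} ¬middle = begin
          tripleProduct z b j w' v                         ≈⟨ tripleProduct-entry z b j w' v ⟩
          I (rel y w') z * I (rel w' v) b * I (rel y v) j  ≈⟨ *-congʳ (I*I≈0 ¬middle) ⟩
          0# * I (rel y v) j                               ≈⟨ zeroˡ _ ⟩
          0#                                               ∎

    UnitColumnsOver-· : ∀ {A B i k l} → UnitColumnsOver A i k → UnitColumnsOver B k l → UnitColumnsOver (A · B) i l
    UnitColumnsOver-· {A} {B} A-cols B-cols v yv =
      let w , yw , B-col = B-cols v yv
          u , yu , A-col = A-cols w yw
      in u , yu , UnitColumn-· {A = A} {B} A-col B-col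

    chain-unitColumns :
      (∀ A B → InSpan (tripleProducts S y) A → InSpan (tripleProducts S y) B →
               InSpan (tripleProducts S y) (A · B)) →
      ∀ a (i j k : Fin (suc a) → Fin (suc d)) →
      (∀ b → p (i b) (j b) (k b) ≡ 1) → (∀ c → k (inject₁ c) ≡ i (suc c)) →
      ∃[ M ] (InSpan (tripleProducts S y) M × UnitColumnsOver M (i zero) (k (fromℕ a)))
    chain-unitColumns closed zero i j k p≡1 _ =
      tripleProduct (i zero) (j zero) (k zero) ,
      tripleProduct-InSpan (i zero) (j zero) (k zero) ,
      tripleProduct-unitColumns (p≡1 zero)
    chain-unitColumns closed (suc a) i j k p≡1 linked =
      let M , M∈span , M-cols = chain-unitColumns closed a (i ∘ suc) (j ∘ suc) (k ∘ suc) (p≡1 ∘ suc) (linked ∘ suc)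
          head = tripleProduct (i zero) (j zero) (k zero)
      in head · M ,
         closed head M (tripleProduct-InSpan (i zero) (j zero) (k zero)) M∈span ,
         UnitColumnsOver-· (tripleProduct-unitColumns (p≡1 zero))
                           (P.subst (λ i₁ → UnitColumnsOver M i₁ _) (P.sym (linked zero)) M-cols)

  module _ {m d : ℕ} (S : AssociationScheme (suc m) d) (y : Fin (suc m)) where
    open AssociationScheme S

    no-unitColumns-in-span : ∀ {M i k} → InSpan (tripleProducts S y) M → UnitColumnsOver S y M i k →
      yR-size S y i ≡ 2 → 1 ≤ yR-size S y k → prodSize S (tr i) k ≡ 1 → ⊥
    no-unitColumns-in-span {M} M∈span M-cols size-i≡2 size-k≥1 ps =
      let v , yv = countEq-witness (rel y) _ size-k≥1
          u , yu , Muv≈1 , M-col = M-cols v yv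
          u' , u'≢u , yu' = countEq-another-witness (rel y) _ (≤-reflexive (P.sym size-i≡2)) u
          Mu'v≈Muv = InSpan-tripleProducts-entry-≈ S y M∈span
                       (P.trans yu' (P.sym yu)) (prodSize≡1⇒rel-constant S ps yu' yu yv) P.refl
      in 0≉1 (trans (sym (M-col u' u'≢u)) (trans Mu'v≈Muv Muv≈1))

-- Valencies are measured at the point zero, so the argument runs there.
corollary4p11 : {c ℓ : Level} (F : Field c ℓ) {m d : ℕ} (S : AssociationScheme (suc m) d) →
    Matrices.TriplyRegular F S →
    (u v : Fin (suc d)) → ¬ BadPair S u v
corollary4p11 F S triply-regular _ _ (a , _ , i , j , k , _ , _ , valency-i , valency-k , p≡1 , linked , prodSize≡1) =
  let M , M∈span , M-cols = chain-unitColumns F S zero (proj₂ (triply-regular zero)) a i j k p≡1 linked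
  in no-unitColumns-in-span F S zero M∈span M-cols (valency-i zero)
       (P.subst (1 ≤_) (P.sym (valency-k (fromℕ a))) (s≤s z≤n)) prodSize≡1
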